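{- Let $e\geq2$, $l\geq1$, $\mathbf{s}\in\mathbb{Z}^l$ and let $\boldsymbol{\lambda}$ be an $l$-partition. Then $$\|\boldsymbol{\lambda}\|^{(e,\mathbf{s})}=\|(\emptyset,\ldots,\emptyset)\|^{(e,\mathbf{s})}-p_{(e,\mathbf{s})}(\boldsymbol{\lambda}).$$
   Context: An $l$-partition $\boldsymbol{\lambda}=(\lambda^1,\ldots,\lambda^l)$ is an $l$-tuple of partitions, with nodes $(a,b,c)$, $a\geq1$, $1\leq c\leq l$, $1\leq b\leq\lambda^c_a$. For $\mathbf{s}=(s_1,\ldots,s_l)\in\mathbb{Z}^l$, the residue of $(a,b,c)$ is $b-a+s_c\bmod e$ and $c^{e,\mathbf{s}}_i(\boldsymbol{\lambda})$ ($i\in\mathbb{Z}/e\mathbb{Z}$) is the number of nodes of residue $i$. The block weight is $p_{(e,\mathbf{s})}(\boldsymbol{\lambda})=\sum_{k=1}^l c^{e,\mathbf{s}}_{s_k \bmod e}(\boldsymbol{\lambda})-\frac12\sum_{i\in\mathbb{Z}/e\mathbb{Z}}\big(c^{e,\mathbf{s}}_i(\boldsymbol{\lambda})-c^{e,\mathbf{s}}_{i-1}(\boldsymbol{\lambda})\big)^2$. Let $\mathfrak{h}^*$ be the $\mathbb{Q}$-vector space with basis $\Lambda_0,\ldots,\Lambda_{e-1},\delta$ (indices of $\Lambda$ taken modulo $e$), and set $\alpha_i=-\Lambda_{i-1}+2\Lambda_i-\Lambda_{i+1}+\delta_{i,0}\delta$ for $0\leq i\leq e-1$; then $\delta=\alpha_0+\cdots+\alpha_{e-1}$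 and $(\Lambda_0,\alpha_0,\ldots,\alpha_{e-1})$ is a basis. Let $a_{ij}$ be the coefficient of $\Lambda_j$ in $\alpha_i$ (Cartan matrix of type $A^{(1)}_{e-1}$), and let $(\cdot,\cdot)$ be the symmetric bilinear form on $\mathfrak{h}^*$ with $(\alpha_i,\alpha_j)=a_{ij}$, $(\Lambda_0,\alpha_i)=\delta_{i,0}$, $(\Lambda_0,\Lambda_0)=0$; then $(\Lambda_i,\alpha_j)=\delta_{ij}$, $(\delta,\alpha_i)=0$, $(\delta,\delta)=0$, $(\delta,\Lambda_i)=1$. Let $s'_k\in\{0,\ldots,e-1\}$ with $s'_k\equiv s_k\pmod e$, $\Lambda_{\mathbf{s}}=\Lambda_{s_1}+\cdots+\Lambda_{s_l}$, $\Delta_{\mathbf{s}}=\frac12\sum_{k=1}^l\big((\tfrac{s_k^2}{e}-s_k)-(\tfrac{s'^2_k}{e}-s'_k)\big)$, $\alpha^{e,\mathbf{s}}(\boldsymbol{\lambda})=-\Delta_{\mathbf{s}}\delta+\Lambda_{\mathbf{s}}-\sum_{i=0}^{e-1}c^{e,\mathbf{s}}_i(\boldsymbol{\lambda})\alpha_i$, and $\|\boldsymbol{\lambda}\|^{(e,\mathbf{s})}=\frac12(\alpha^{e,\mathbf{s}}(\boldsymbol{\lambda}),\alpha^{e,\mathbf{s}}(\boldsymbol{\lambda}))$. -}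

module Defs where

open import Data.Nat as ℕ using (ℕ; zero; suc; NonZero; _≥_; _<_)
open import Data.Integer as ℤ using (ℤ; +_)
open import Data.Integer.DivMod using (_%ℕ_)
open import Data.Rational as ℚ using (ℚ; ½; 0ℚ; 1ℚ)
open import Data.Fin as Fin using (Fin; toℕ)
open import Data.List as List using (List; []; _∷_; length; filter; map; concat; upTo)
open import Data.List.Relation.Unary.All using (All)
open import Data.List.Relation.Unary.Linked using (Linked)
open import Data.Vec as Vec using (Vec; toList; zipWith)
open import Data.Product using (_×_; _,_; proj₁; proj₂)
open import Relation.Binary.PropositionalEquality using (_≡_)
open import Relation.Nullary.Decidable using (⌊_⌋; Dec)
open import Data.Bool using (if_then_else_)
import Data.Nat.Properties as ℕP

IsPartition : List ℕ → Set
IsPartition p = Linked _≥_ p × All (0 <_) p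

IsMultipartition : ∀ {l} → Vec (List ℕ) l → Set
IsMultipartition λs = All IsPartition (toList λs)

emptyMP : (l : ℕ) → Vec (List ℕ) l
emptyMP l = Vec.replicate l []

-- Residues / contents.  The node (a,b,c) of λ has content b - a + s_c.

-- contents of row a (1-indexed) of length n in component with charge s
rowContents : ℤ → ℕ → ℕ → List ℤ
rowContents s a n = map (λ j → (+ suc j ℤ.- + a) ℤ.+ s) (upTo n)

partContentsFrom : ℤ → ℕ → List ℕ → List ℤ
partContentsFrom s a []       = []
partContentsFrom s a (n ∷ ns) = rowContents s a n List.++ partContentsFrom s (suc a) ns

partContents : ℤ → List ℕ → List ℤ
partContents s p = partContentsFrom s 1 p

contents : ∀ {l} → Vec ℤ l → Vec (List ℕ) l → List ℤ
contents s λs = concat (toList (zipWith partContents s λs))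

resCount : (e : ℕ) .{{_ : NonZero e}} → ∀ {l} → Vec ℤ l → Vec (List ℕ) l → ℤ → ℕ
resCount e s λs i = length (filter (λ x → (x %ℕ e) ℕ.≟ (i %ℕ e)) (contents s λs))

ℤtoℚ : ℤ → ℚ
ℤtoℚ z = z ℚ./ 1

ℕtoℚ : ℕ → ℚ
ℕtoℚ n = ℤtoℚ (+ n)

sumFin : (n : ℕ) → (Fin n → ℚ) → ℚ
sumFin zero    f = 0ℚ
sumFin (suc n) f = f Fin.zero ℚ.+ sumFin n (λ i → f (Fin.suc i))

sumVec : ∀ {n} → Vec ℚ n → ℚ
sumVec v = Vec.foldr _ ℚ._+_ 0ℚ v

blockWeight : (e : ℕ) .{{_ : NonZero e}} → ∀ {l} → Vec ℤ l → Vec (List ℕ) l → ℚ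
blockWeight e s λs =
  sumVec (Vec.map (λ sk → ℕtoℚ (c sk)) s)
  ℚ.- ½ ℚ.* sumFin e (λ i → let d = ℕtoℚ (c (+ toℕ i)) ℚ.- ℕtoℚ (c (+ toℕ i ℤ.- + 1)) in d ℚ.* d)
  where
  c : ℤ → ℕ
  c = resCount e s λs

-- The space h* with basis Λ_0,...,Λ_{e-1}, δ : an element is
-- (coefficients of Λ_0..Λ_{e-1}, coefficient of δ).

H* : ℕ → Set
H* e = (Fin e → ℚ) × ℚ

_⊕_ : ∀ {e} → H* e → H* e → H* e
(u , a) ⊕ (v , b) = (λ j → u j ℚ.+ v j) , (a ℚ.+ b)

_⊙_ : ∀ {e} → ℚ → H* e → H* e
q ⊙ (u , a) = (λ j → q ℚ.* u j) , (q ℚ.* a)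

zeroH : ∀ {e} → H* e
zeroH = (λ _ → 0ℚ) , 0ℚ

Λ : (e : ℕ) .{{_ : NonZero e}} → ℤ → H* e
Λ e k = (λ j → if ⌊ toℕ j ℕ.≟ (k %ℕ e) ⌋ then 1ℚ else 0ℚ) , 0ℚ

δ : ∀ {e} → H* e
δ = (λ _ → 0ℚ) , 1ℚ

α : (e : ℕ) .{{_ : NonZero e}} → Fin e → H* e
α e i =
  ((ℚ.- 1ℚ) ⊙ Λ e (+ toℕ i ℤ.- + 1)) ⊕ ((ℕtoℚ 2 ⊙ Λ e (+ toℕ i)) ⊕
  (((ℚ.- 1ℚ) ⊙ Λ e (+ toℕ i ℤ.+ + 1)) ⊕ kron i))
  where
  kron : Fin e → H* e
  kron Fin.zero    = δ
  kron (Fin.suc _) = zeroH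

cartan : (e : ℕ) .{{_ : NonZero e}} → Fin e → Fin e → ℚ
cartan e i j = proj₁ (α e i) j

-- Symmetric bilinear forms on h*, given by their Gram data on the basis
-- Λ_0..Λ_{e-1}, δ.

record GramData (e : ℕ) : Set where
  field
    gΛΛ : Fin e → Fin e → ℚ
    gΛδ : Fin e → ℚ
    gδδ : ℚ
    symm : ∀ i j → gΛΛ i j ≡ gΛΛ j i

form : ∀ {e} → GramData e → H* e → H* e → ℚ
form {e} G (u , a) (v , b) =
  sumFin e (λ i → sumFin e (λ j → u i ℚ.* v j ℚ.* gΛΛ i j))
  ℚ.+ sumFin e (λ i → (u i ℚ.* b ℚ.+ v i ℚ.* a) ℚ.* gΛδ i)
  ℚ.+ a ℚ.* b ℚ.* gδδ
  where open GramData G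

kron0 : ∀ {e} → Fin e → ℚ
kron0 Fin.zero    = 1ℚ
kron0 (Fin.suc _) = 0ℚ

record IsStandardForm (e : ℕ) .{{_ : NonZero e}} (G : GramData e) : Set where
  field
    αα : ∀ i j → form G (α e i) (α e j) ≡ cartan e i j
    Λ₀α : ∀ (i : Fin e) → form G (Λ e (+ 0)) (α e i) ≡ kron0 i
    Λ₀Λ₀ : form G (Λ e (+ 0)) (Λ e (+ 0)) ≡ 0ℚ

sumH : ∀ {e n} → Vec (H* e) n → H* e
sumH = Vec.foldr _ _⊕_ zeroH

sumHFin : ∀ {e} (n : ℕ) → (Fin n → H* e) → H* e
sumHFin zero    f = zeroH
sumHFin (suc n) f = f Fin.zero ⊕ sumHFin n (λ i → f (Fin.suc i))

Λs : (e : ℕ) .{{_ : NonZero e}} → ∀ {l} → Vec ℤ l → H* e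
Λs e s = sumH (Vec.map (Λ e) s)

Δs : (e : ℕ) .{{_ : NonZero e}} → ∀ {l} → Vec ℤ l → ℚ
Δs e s = ½ ℚ.* sumVec (Vec.map term s)
  where
  f : ℤ → ℚ
  f x = ((x ℤ.* x) ℚ./ e) ℚ.- ℤtoℚ x
  term : ℤ → ℚ
  term sk = f sk ℚ.- f (+ (sk %ℕ e))

αλ : (e : ℕ) .{{_ : NonZero e}} → ∀ {l} → Vec ℤ l → Vec (List ℕ) l → H* e
αλ e s λs =
  ((ℚ.- Δs e s) ⊙ δ) ⊕ (Λs e s ⊕
  ((ℚ.- 1ℚ) ⊙ sumHFin e (λ i → ℕtoℚ (resCount e s λs (+ toℕ i)) ⊙ α e i)))

norm : (e : ℕ) .{{_ : NonZero e}} → GramData e → ∀ {l} → Vec ℤ l → Vec (List ℕ) l → ℚ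
norm e G s λs = ½ ℚ.* form G (αλ e s λs) (αλ e s λs)

module Submission where

-- Write α^{e,s}(λ) = D + Λ_s - S_λ with D = -Δ_s δ and S_λ = Σ_i c_i(λ) α_i; for the
-- empty multipartition S_∅ = 0.  Expanding the square by bilinearity,
--   ‖λ‖ = ‖∅‖ - ((D , S_λ) + (Λ_s , S_λ) - ½ (S_λ , S_λ)).
-- The form satisfies (Λ_m , α_i) = [m ≡ i mod e] and (δ , α_i) = 0: the linear
-- functional x ↦ (x , α_i) - x_i vanishes on Λ_0 and on every α_j, and since
-- Λ_0, α_0, …, α_{e-1} span h* it vanishes on all Λ_m and on δ (its values on
-- Λ_0, Λ_1, … have equal steps and are e-periodic, hence zero in characteristic 0).
-- Consequently (D , S_λ) = 0, (Λ_s , S_λ) = Σ_k c_{s_k}, and by cyclic summation by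
-- parts (S_λ , S_λ) = Σ_i c_i (2c_i - c_{i-1} - c_{i+1}) = Σ_i (c_i - c_{i-1})², which
-- is exactly the block weight.

open import Defs
open import Data.Nat as ℕ using (ℕ; NonZero; _≤_; zero; suc; s≤s)
import Data.Nat.Properties as ℕP
import Data.Nat.DivMod as ℕD
open import Data.Integer as ℤ using (ℤ; -[1+_])
open import Data.Integer.DivMod using (_%ℕ_; n%ℕd<d)
open import Data.Rational as ℚ using (ℚ; _-_; _+_; _*_; -_; 0ℚ; 1ℚ; ½)
import Data.Rational.Properties as ℚP
open import Data.Fin using (Fin; zero; suc; toℕ; fromℕ<)
import Data.Fin.Properties as FinP
open import Data.List using (List; []; length; filter)
open import Data.Vec as Vec using (Vec; []; _∷_)
open import Data.Bool using (if_then_else_)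
open import Data.Product using (_,_; proj₁)
open import Function using (_∘_; mk⇔)
open import Level using (0ℓ)
open import Relation.Nullary.Decidable using (⌊_⌋; does; isYes≗does; does-⇔; dec⇒maybe)
open import Relation.Binary.PropositionalEquality
open import Tactic.RingSolver using (solve-∀)
open import Tactic.RingSolver.Core.AlmostCommutativeRing using (AlmostCommutativeRing; fromCommutativeRing)
open import Algebra.Bundles using (CommutativeRing)
open import Algebra.Properties.Group ℚP.+-0-group using (x∙y⁻¹≈ε⇒x≈y)
open import Algebra.Properties.Semiring.Sum (CommutativeRing.semiring ℚP.+-*-commutativeRing)
  using (sum; sum-cong-≗; ∑-distrib-+; ∑-comm; *-distribˡ-sum)

open ≡-Reasoning

ℚ-ring : AlmostCommutativeRing 0ℓ 0ℓ
ℚ-ring = fromCommutativeRing ℚP.+-*-commutativeRing (λ x → dec⇒maybe (0ℚ ℚP.≟ x))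

sumFin≡sum : ∀ n (f : Fin n → ℚ) → sumFin n f ≡ sum f
sumFin≡sum zero    f = refl
sumFin≡sum (suc n) f = cong (f zero +_) (sumFin≡sum n (f ∘ suc))

sumFin-cong : ∀ n {f g : Fin n → ℚ} → (∀ i → f i ≡ g i) → sumFin n f ≡ sumFin n g
sumFin-cong n {f} {g} f≗g = begin
  sumFin n f ≡⟨ sumFin≡sum n f ⟩
  sum f      ≡⟨ sum-cong-≗ f≗g ⟩
  sum g      ≡⟨ sumFin≡sum n g ⟨
  sumFin n g ∎

sumFin-+ : ∀ n (f g : Fin n → ℚ) → sumFin n (λ i → f i + g i) ≡ sumFin n f + sumFin n g
sumFin-+ n f g = begin
  sumFin n (λ i → f i + g i) ≡⟨ sumFin≡sum n _ ⟩
  sum (λ i → f i + g i)      ≡⟨ ∑-distrib-+ f g ⟩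
  sum f + sum g              ≡⟨ cong₂ _+_ (sumFin≡sum n f) (sumFin≡sum n g) ⟨
  sumFin n f + sumFin n g    ∎

sumFin-* : ∀ n q (f : Fin n → ℚ) → sumFin n (λ i → q * f i) ≡ q * sumFin n f
sumFin-* n q f = begin
  sumFin n (λ i → q * f i) ≡⟨ sumFin≡sum n _ ⟩
  sum (λ i → q * f i)      ≡⟨ *-distribˡ-sum q f ⟨
  q * sum f                ≡⟨ cong (q *_) (sumFin≡sum n f) ⟨
  q * sumFin n f           ∎

sumFin-comm : ∀ m n (f : Fin m → Fin n → ℚ) →
  sumFin m (λ i → sumFin n (f i)) ≡ sumFin n (λ j → sumFin m (λ i → f i j))
sumFin-comm m n f = begin
  sumFin m (λ i → sumFin n (f i))           ≡⟨ trans (sumFin≡sum m _) (sum-cong-≗ (λ i → sumFin≡sum n (f i))) ⟩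
  sum (λ i → sum (f i))                     ≡⟨ ∑-comm f ⟩
  sum (λ j → sum (λ i → f i j))             ≡⟨ trans (sumFin≡sum n _) (sum-cong-≗ (λ j → sumFin≡sum m (λ i → f i j))) ⟨
  sumFin n (λ j → sumFin m (λ i → f i j))  ∎

sumFin-telescope : ∀ n (g : ℕ → ℚ) → sumFin n (λ i → g (suc (toℕ i)) - g (toℕ i)) ≡ g n - g 0
sumFin-telescope zero    g = sym (ℚP.+-inverseʳ (g 0))
sumFin-telescope (suc n) g = begin
  (g 1 - g 0) + sumFin n (λ i → g (suc (suc (toℕ i))) - g (suc (toℕ i)))
    ≡⟨ cong ((g 1 - g 0) +_) (sumFin-telescope n (g ∘ suc)) ⟩
  (g 1 - g 0) + (g (suc n) - g 1)
    ≡⟨ chain (g 0) (g 1) (g (suc n)) ⟩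
  g (suc n) - g 0 ∎
  where
  chain : ∀ a b c → (b - a) + (c - b) ≡ c - a
  chain = solve-∀ ℚ-ring

indicator : ℕ → ℕ → ℚ
indicator r t = if ⌊ t ℕ.≟ r ⌋ then 1ℚ else 0ℚ

indicator-suc : ∀ r t → indicator (suc r) (suc t) ≡ indicator r t
indicator-suc r t =
  cong (λ b → if b then 1ℚ else 0ℚ) (begin
    ⌊ suc t ℕ.≟ suc r ⌋ ≡⟨ isYes≗does (suc t ℕ.≟ suc r) ⟩
    does (suc t ℕ.≟ suc r) ≡⟨ does-⇔ (mk⇔ ℕP.suc-injective (cong suc)) (suc t ℕ.≟ suc r) (t ℕ.≟ r) ⟩
    does (t ℕ.≟ r) ≡⟨ isYes≗does (t ℕ.≟ r) ⟨
    ⌊ t ℕ.≟ r ⌋ ∎)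

sumFin-indicator : ∀ n (h : ℕ → ℚ) r → r ℕ.< n →
  sumFin n (λ j → indicator r (toℕ j) * h (toℕ j)) ≡ h r
sumFin-indicator (suc n) h zero _ = begin
  1ℚ * h 0 + sumFin n (λ j → 0ℚ * h (suc (toℕ j))) ≡⟨ cong (1ℚ * h 0 +_) (sumFin-* n 0ℚ (h ∘ suc ∘ toℕ)) ⟩
  1ℚ * h 0 + 0ℚ * sumFin n (h ∘ suc ∘ toℕ)          ≡⟨ drop-zero (h 0) (sumFin n (h ∘ suc ∘ toℕ)) ⟩
  h 0                                                ∎
  where
  drop-zero : ∀ a b → 1ℚ * a + 0ℚ * b ≡ a
  drop-zero = solve-∀ ℚ-ring
sumFin-indicator (suc n) h (suc r) (s≤s r<n) = begin
  0ℚ * h 0 + sumFin n (λ j → indicator (suc r) (suc (toℕ j)) * h (suc (toℕ j)))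
    ≡⟨ cong₂ _+_ (ℚP.*-zeroˡ (h 0)) (sumFin-cong n (λ j → cong (_* h (suc (toℕ j))) (indicator-suc r (toℕ j)))) ⟩
  0ℚ + sumFin n (λ j → indicator r (toℕ j) * h (suc (toℕ j)))
    ≡⟨ ℚP.+-identityˡ _ ⟩
  sumFin n (λ j → indicator r (toℕ j) * h (suc (toℕ j)))
    ≡⟨ sumFin-indicator n (h ∘ suc) r r<n ⟩
  h (suc r) ∎

ι : ℕ → ℚ
ι zero    = 0ℚ
ι (suc n) = 1ℚ + ι n

ι-nonNegative : ∀ n → ℚ.NonNegative (ι n)
ι-nonNegative zero    = _
ι-nonNegative (suc n) = ℚP.nonNeg+nonNeg⇒nonNeg 1ℚ (ι n) {{ι-nonNegative n}}

ι-suc-cancel : ∀ n x → ι (suc n) * x ≡ 0ℚ → x ≡ 0ℚ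
ι-suc-cancel n x n+1·x≡0 = begin
  x                ≡⟨ ℚP.*-identityˡ x ⟨
  1ℚ * x           ≡⟨ cong (_* x) (ℚP.*-inverseˡ p {{p≢0}}) ⟨
  (p⁻¹ * p) * x    ≡⟨ ℚP.*-assoc p⁻¹ p x ⟩
  p⁻¹ * (p * x)    ≡⟨ cong (p⁻¹ *_) n+1·x≡0 ⟩
  p⁻¹ * 0ℚ         ≡⟨ ℚP.*-zeroʳ p⁻¹ ⟩
  0ℚ               ∎
  where
  p : ℚ
  p = ι (suc n)
  p≢0 : ℚ.NonZero p
  p≢0 = ℚP.pos⇒nonZero p {{ℚP.pos+nonNeg⇒pos 1ℚ (ι n) {{ι-nonNegative n}}}}
  p⁻¹ : ℚ
  p⁻¹ = ℚ.1/_ p {{p≢0}}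

-- A rational sequence on {0,…,k+1} whose consecutive differences all agree and
-- whose two endpoint values agree is constant: it is linear, z j = z 0 + j·d,
-- and z (k+1) = z 0 forces d = 0.
equal-steps-constant : ∀ k (z : ℕ → ℚ) →
  (∀ j → j ℕ.< k → z (suc (suc j)) - z (suc j) ≡ z (suc j) - z j) →
  z (suc k) ≡ z 0 → ∀ j → j ℕ.≤ suc k → z j ≡ z 0
equal-steps-constant k z equal-steps closed j j≤k+1 = begin
  z j            ≡⟨ linear j j≤k+1 ⟩
  z 0 + ι j * d  ≡⟨ cong (λ t → z 0 + ι j * t) d≡0 ⟩
  z 0 + ι j * 0ℚ ≡⟨ drop-zero (z 0) (ι j) ⟩
  z 0            ∎
  where
  add-sub : ∀ a x → x ≡ (a + x) - a
  add-sub = solve-∀ ℚ-ring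
  start : ∀ a x → a ≡ a + 0ℚ * x
  start = solve-∀ ℚ-ring
  telescope : ∀ a b → b ≡ a + (b - a)
  telescope = solve-∀ ℚ-ring
  add-step : ∀ a r x → (a + r * x) + x ≡ a + (1ℚ + r) * x
  add-step = solve-∀ ℚ-ring
  drop-zero : ∀ a r → a + r * 0ℚ ≡ a
  drop-zero = solve-∀ ℚ-ring
  cancel-left : ∀ a x → a ≡ a + x → x ≡ 0ℚ
  cancel-left a x a≡a+x = begin
    x             ≡⟨ add-sub a x ⟩
    (a + x) - a   ≡⟨ cong (_- a) a≡a+x ⟨
    a - a         ≡⟨ ℚP.+-inverseʳ a ⟩
    0ℚ            ∎

  d : ℚ
  d = z 1 - z 0

  step : ∀ j → j ℕ.≤ k → z (suc j) - z j ≡ d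
  step zero    _   = refl
  step (suc j) j<k = trans (equal-steps j j<k) (step j (ℕP.<⇒≤ j<k))

  linear : ∀ j → j ℕ.≤ suc k → z j ≡ z 0 + ι j * d
  linear zero    _         = start (z 0) d
  linear (suc j) (s≤s j≤k) = begin
    z (suc j)                   ≡⟨ telescope (z j) (z (suc j)) ⟩
    z j + (z (suc j) - z j)     ≡⟨ cong₂ _+_ (linear j (ℕP.m≤n⇒m≤1+n j≤k)) (step j j≤k) ⟩
    (z 0 + ι j * d) + d         ≡⟨ add-step (z 0) (ι j) d ⟩
    z 0 + (1ℚ + ι j) * d        ∎

  d≡0 : d ≡ 0ℚ
  d≡0 = ι-suc-cancel k d (cancel-left (z 0) (ι (suc k) * d) (trans (sym closed) (linear (suc k) ℕP.≤-refl)))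

record Linear {e : ℕ} (ψ : H* e → ℚ) : Set where
  field
    additive    : ∀ x y → ψ (x ⊕ y) ≡ ψ x + ψ y
    homogeneous : ∀ q x → ψ (q ⊙ x) ≡ q * ψ x
open Linear

linear-ext : ∀ {e} {ψ φ : H* e → ℚ} → (∀ x → ψ x ≡ φ x) → Linear φ → Linear ψ
linear-ext ψ≗φ lin-φ = record
  { additive    = λ x y → trans (ψ≗φ (x ⊕ y)) (trans (additive lin-φ x y) (sym (cong₂ _+_ (ψ≗φ x) (ψ≗φ y))))
  ; homogeneous = λ q x → trans (ψ≗φ (q ⊙ x)) (trans (homogeneous lin-φ q x) (sym (cong (q *_) (ψ≗φ x))))
  }

linear-sub : ∀ {e} {ψ φ : H* e → ℚ} → Linear ψ → Linear φ → Linear (λ x → ψ x - φ x)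
linear-sub {ψ = ψ} {φ} lin-ψ lin-φ = record
  { additive    = λ x y → trans (cong₂ _-_ (additive lin-ψ x y) (additive lin-φ x y))
                                (sub-add (ψ x) (ψ y) (φ x) (φ y))
  ; homogeneous = λ q x → trans (cong₂ _-_ (homogeneous lin-ψ q x) (homogeneous lin-φ q x))
                                (sub-scale q (ψ x) (φ x))
  }
  where
  sub-add : ∀ a b c d → (a + b) - (c + d) ≡ (a - c) + (b - d)
  sub-add = solve-∀ ℚ-ring
  sub-scale : ∀ q a c → q * a - q * c ≡ q * (a - c)
  sub-scale = solve-∀ ℚ-ring

linear-zero : ∀ {e} {ψ : H* e → ℚ} → Linear ψ → ψ zeroH ≡ 0ℚ
linear-zero {ψ = ψ} lin = trans (homogeneous lin 0ℚ zeroH) (ℚP.*-zeroˡ (ψ zeroH))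

linear-sumHFin : ∀ {e} {ψ : H* e → ℚ} → Linear ψ →
  ∀ n (f : Fin n → H* e) → ψ (sumHFin n f) ≡ sumFin n (ψ ∘ f)
linear-sumHFin lin zero    f = linear-zero lin
linear-sumHFin {ψ = ψ} lin (suc n) f =
  trans (additive lin (f zero) (sumHFin n (f ∘ suc))) (cong (ψ (f zero) +_) (linear-sumHFin lin n (f ∘ suc)))

linear-combination : ∀ {e} {ψ : H* e → ℚ} → Linear ψ →
  ∀ x y q w → ψ (x ⊕ (y ⊕ (q ⊙ w))) ≡ ψ x + (ψ y + q * ψ w)
linear-combination {ψ = ψ} lin x y q w =
  trans (additive lin x (y ⊕ (q ⊙ w)))
        (cong (ψ x +_) (trans (additive lin y (q ⊙ w)) (cong (ψ y +_) (homogeneous lin q w))))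

coordinate-linear : ∀ {e} (i : Fin e) → Linear (λ (x : H* e) → proj₁ x i)
coordinate-linear i = record { additive = λ _ _ → refl ; homogeneous = λ _ _ → refl }

pairing : ∀ {e} → H* e → H* e → ℚ
pairing {e} (w , t) (u , a) = sumFin e (λ i → u i * w i) + a * t

pairing-linear : ∀ {e} (w : H* e) → Linear (pairing w)
pairing-linear {e} (w , t) = record
  { additive    = λ { (u , a) (v , b) → begin
      sumFin e (λ i → (u i + v i) * w i) + (a + b) * t
        ≡⟨ cong (_+ (a + b) * t) (trans (sumFin-cong e (λ i → ℚP.*-distribʳ-+ (w i) (u i) (v i)))
                                         (sumFin-+ e _ _)) ⟩
      (sumFin e (λ i → u i * w i) + sumFin e (λ i → v i * w i)) + (a + b) * t
        ≡⟨ regroup (sumFin e (λ i → u i * w i)) (sumFin e (λ i → v i * w i)) a b t ⟩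
      (sumFin e (λ i → u i * w i) + a * t) + (sumFin e (λ i → v i * w i) + b * t) ∎ }
  ; homogeneous = λ { q (u , a) → begin
      sumFin e (λ i → (q * u i) * w i) + (q * a) * t
        ≡⟨ cong (_+ (q * a) * t) (trans (sumFin-cong e (λ i → ℚP.*-assoc q (u i) (w i))) (sumFin-* e q _)) ⟩
      q * sumFin e (λ i → u i * w i) + (q * a) * t
        ≡⟨ factor q (sumFin e (λ i → u i * w i)) a t ⟩
      q * (sumFin e (λ i → u i * w i) + a * t) ∎ }
  }
  where
  regroup : ∀ p r a b t → (p + r) + (a + b) * t ≡ (p + a * t) + (r + b * t)
  regroup = solve-∀ ℚ-ring
  factor : ∀ q p a t → q * p + (q * a) * t ≡ q * (p + a * t)
  factor = solve-∀ ℚ-ring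

module GramForm {e : ℕ} (G : GramData e) where
  open GramData G

  B : H* e → H* e → ℚ
  B = form G

  -- The dual coordinates of the functional x ↦ (x , y).
  dual : H* e → H* e
  dual (v , b) = (λ i → sumFin e (λ j → v j * gΛΛ i j) + b * gΛδ i)
               , (sumFin e (λ i → v i * gΛδ i) + b * gδδ)

  -- Unfolding the Gram data exhibits y ↦ (x , y) in dual coordinates; linearity in
  -- the first argument is then an instance of `pairing-linear`.
  form-pairing : ∀ x y → B x y ≡ pairing (dual y) x
  form-pairing (u , a) (v , b) = begin
    sumFin e (λ i → sumFin e (λ j → u i * v j * gΛΛ i j)) + sumFin e (λ i → (u i * b + v i * a) * gΛδ i) + a * b * gδδ
      ≡⟨ cong₂ (λ p q → p + q + a * b * gδδ) ΛΛ-part Λδ-part ⟩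
    P + (Q + a * C) + a * b * gδδ
      ≡⟨ regroup P Q a C b gδδ ⟩
    (P + Q) + a * (C + b * gδδ)
      ≡⟨ cong (_+ a * (C + b * gδδ)) (trans (sumFin-cong e (λ i → ℚP.*-distribˡ-+ (u i) (X i) (b * gΛδ i)))
                                            (sumFin-+ e (λ i → u i * X i) (λ i → u i * (b * gΛδ i)))) ⟨
    sumFin e (λ i → u i * (X i + b * gΛδ i)) + a * (C + b * gδδ) ∎
    where
    X : Fin e → ℚ
    X i = sumFin e (λ j → v j * gΛΛ i j)
    P Q C : ℚ
    P = sumFin e (λ i → u i * X i)
    Q = sumFin e (λ i → u i * (b * gΛδ i))
    C = sumFin e (λ i → v i * gΛδ i)
    ΛΛ-part : sumFin e (λ i → sumFin e (λ j → u i * v j * gΛΛ i j)) ≡ P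
    ΛΛ-part = sumFin-cong e (λ i →
      trans (sumFin-cong e (λ j → ℚP.*-assoc (u i) (v j) (gΛΛ i j))) (sumFin-* e (u i) (λ j → v j * gΛΛ i j)))
    spread : ∀ u v a b h → (u * b + v * a) * h ≡ u * (b * h) + a * (v * h)
    spread = solve-∀ ℚ-ring
    Λδ-part : sumFin e (λ i → (u i * b + v i * a) * gΛδ i) ≡ Q + a * C
    Λδ-part = begin
      sumFin e (λ i → (u i * b + v i * a) * gΛδ i)
        ≡⟨ sumFin-cong e (λ i → spread (u i) (v i) a b (gΛδ i)) ⟩
      sumFin e (λ i → u i * (b * gΛδ i) + a * (v i * gΛδ i))
        ≡⟨ sumFin-+ e (λ i → u i * (b * gΛδ i)) (λ i → a * (v i * gΛδ i)) ⟩
      Q + sumFin e (λ i → a * (v i * gΛδ i))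
        ≡⟨ cong (Q +_) (sumFin-* e a (λ i → v i * gΛδ i)) ⟩
      Q + a * C ∎
    regroup : ∀ p q a c b g → p + (q + a * c) + a * b * g ≡ (p + q) + a * (c + b * g)
    regroup = solve-∀ ℚ-ring

  B-sym : ∀ x y → B x y ≡ B y x
  B-sym (u , a) (v , b) = cong₂ _+_ (cong₂ _+_ ΛΛ-part Λδ-part) (swap a b gδδ)
    where
    swap : ∀ x y g → x * y * g ≡ y * x * g
    swap = solve-∀ ℚ-ring
    swap-sum : ∀ x y z w h → (x * y + z * w) * h ≡ (z * w + x * y) * h
    swap-sum = solve-∀ ℚ-ring
    ΛΛ-part : sumFin e (λ i → sumFin e (λ j → u i * v j * gΛΛ i j)) ≡ sumFin e (λ i → sumFin e (λ j → v i * u j * gΛΛ i j))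
    ΛΛ-part = trans (sumFin-comm e e (λ i j → u i * v j * gΛΛ i j))
                    (sumFin-cong e (λ j → sumFin-cong e (λ i →
                      trans (swap (u i) (v j) (gΛΛ i j)) (cong (v j * u i *_) (symm i j)))))
    Λδ-part : sumFin e (λ i → (u i * b + v i * a) * gΛδ i) ≡ sumFin e (λ i → (v i * a + u i * b) * gΛδ i)
    Λδ-part = sumFin-cong e (λ i → swap-sum (u i) b (v i) a (gΛδ i))

  B-linearˡ : ∀ z → Linear (λ x → B x z)
  B-linearˡ z = linear-ext (λ x → form-pairing x z) (pairing-linear (dual z))

  B-linearʳ : ∀ z → Linear (B z)
  B-linearʳ z = linear-ext (λ x → B-sym z x) (B-linearˡ z)

  B-square : ∀ x y q w →
    B (x ⊕ (y ⊕ (q ⊙ w))) (x ⊕ (y ⊕ (q ⊙ w)))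
      ≡ B x x + B y y + q * q * B w w + (1ℚ + 1ℚ) * (B x y + q * B x w + q * B y w)
  B-square x y q w = begin
    B v v
      ≡⟨ linear-combination (B-linearˡ v) x y q w ⟩
    B x v + (B y v + q * B w v)
      ≡⟨ cong₂ _+_ (row x) (cong₂ (λ a b → a + q * b) (row y) (row w)) ⟩
    (B x x + (B x y + q * B x w)) + ((B y x + (B y y + q * B y w)) + q * (B w x + (B w y + q * B w w)))
      ≡⟨ collect (B x x) (B x y) (B x w) (B y x) (B y y) (B y w) (B w x) (B w y) (B w w) q
                 (B-sym y x) (B-sym w x) (B-sym w y) ⟩
    B x x + B y y + q * q * B w w + (1ℚ + 1ℚ) * (B x y + q * B x w + q * B y w) ∎
    where
    v : H* e
    v = x ⊕ (y ⊕ (q ⊙ w))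
    row : ∀ z → B z v ≡ B z x + (B z y + q * B z w)
    row z = linear-combination (B-linearʳ z) x y q w
    expand : ∀ xx xy xw yy yw ww q →
      (xx + (xy + q * xw)) + ((xy + (yy + q * yw)) + q * (xw + (yw + q * ww)))
        ≡ xx + yy + q * q * ww + (1ℚ + 1ℚ) * (xy + q * xw + q * yw)
    expand = solve-∀ ℚ-ring
    collect : ∀ xx xy xw yx yy yw wx wy ww q → yx ≡ xy → wx ≡ xw → wy ≡ yw →
      (xx + (xy + q * xw)) + ((yx + (yy + q * yw)) + q * (wx + (wy + q * ww)))
        ≡ xx + yy + q * q * ww + (1ℚ + 1ℚ) * (xy + q * xw + q * yw)
    collect xx xy xw _ yy yw _ _ ww q refl refl refl = expand xx xy xw yy yw ww q

  half-square-shift : ∀ x y w w₀ → (∀ z → B w₀ z ≡ 0ℚ) →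
    ½ * B (x ⊕ (y ⊕ ((- 1ℚ) ⊙ w))) (x ⊕ (y ⊕ ((- 1ℚ) ⊙ w)))
      ≡ ½ * B (x ⊕ (y ⊕ ((- 1ℚ) ⊙ w₀))) (x ⊕ (y ⊕ ((- 1ℚ) ⊙ w₀))) - (B x w + B y w - ½ * B w w)
  half-square-shift x y w w₀ w₀⊥ = begin
    ½ * B (x ⊕ (y ⊕ (m1 ⊙ w))) (x ⊕ (y ⊕ (m1 ⊙ w)))
      ≡⟨ cong (½ *_) (B-square x y m1 w) ⟩
    ½ * (B x x + B y y + m1 * m1 * B w w + two * (B x y + m1 * B x w + m1 * B y w))
      ≡⟨ halve ½ refl (B x x) (B y y) (B x y) (B x w) (B y w) (B w w) ⟩
    ½ * (B x x + B y y + m1 * m1 * 0ℚ + two * (B x y + m1 * 0ℚ + m1 * 0ℚ)) - (B x w + B y w - ½ * B w w)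
      ≡⟨ cong (λ t → ½ * t - (B x w + B y w - ½ * B w w)) (sym (trans (B-square x y m1 w₀) vanish)) ⟩
    ½ * B (x ⊕ (y ⊕ (m1 ⊙ w₀))) (x ⊕ (y ⊕ (m1 ⊙ w₀))) - (B x w + B y w - ½ * B w w) ∎
    where
    m1 two : ℚ
    m1 = - 1ℚ
    two = 1ℚ + 1ℚ
    ⊥w₀ : ∀ z → B z w₀ ≡ 0ℚ
    ⊥w₀ z = trans (B-sym z w₀) (w₀⊥ z)
    vanish : B x x + B y y + m1 * m1 * B w₀ w₀ + two * (B x y + m1 * B x w₀ + m1 * B y w₀)
           ≡ B x x + B y y + m1 * m1 * 0ℚ + two * (B x y + m1 * 0ℚ + m1 * 0ℚ)
    vanish = trans (cong₂ (λ a b → B x x + B y y + m1 * m1 * a + two * (B x y + m1 * b + m1 * B y w₀)) (w₀⊥ w₀) (⊥w₀ x))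
                   (cong (λ c → B x x + B y y + m1 * m1 * 0ℚ + two * (B x y + m1 * 0ℚ + m1 * c)) (⊥w₀ y))
    halve : ∀ h → h * two ≡ 1ℚ → ∀ xx yy xy xw yw ww →
      h * (xx + yy + m1 * m1 * ww + two * (xy + m1 * xw + m1 * yw))
        ≡ h * (xx + yy + m1 * m1 * 0ℚ + two * (xy + m1 * 0ℚ + m1 * 0ℚ)) - (xw + yw - h * ww)
    halve h h·2≡1 xx yy xy xw yw ww = begin
      h * (xx + yy + m1 * m1 * ww + two * (xy + m1 * xw + m1 * yw))
        ≡⟨ split h xx yy xy xw yw ww ⟩
      h * (xx + yy + two * xy) - (h * two) * (xw + yw) + h * ww
        ≡⟨ cong (λ t → h * (xx + yy + two * xy) - t * (xw + yw) + h * ww) h·2≡1 ⟩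
      h * (xx + yy + two * xy) - 1ℚ * (xw + yw) + h * ww
        ≡⟨ rejoin h xx yy xy xw yw ww ⟩
      h * (xx + yy + m1 * m1 * 0ℚ + two * (xy + m1 * 0ℚ + m1 * 0ℚ)) - (xw + yw - h * ww) ∎
      where
      split : ∀ h xx yy xy xw yw ww →
        h * (xx + yy + m1 * m1 * ww + two * (xy + m1 * xw + m1 * yw))
          ≡ h * (xx + yy + two * xy) - (h * two) * (xw + yw) + h * ww
      split = solve-∀ ℚ-ring
      rejoin : ∀ h xx yy xy xw yw ww →
        h * (xx + yy + two * xy) - 1ℚ * (xw + yw) + h * ww
          ≡ h * (xx + yy + m1 * m1 * 0ℚ + two * (xy + m1 * 0ℚ + m1 * 0ℚ)) - (xw + yw - h * ww)
      rejoin = solve-∀ ℚ-ring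

+-one : ∀ n → ℤ.+ n ℤ.+ ℤ.+ 1 ≡ ℤ.+ suc n
+-one n = cong ℤ.+_ (ℕP.+-comm n 1)

minus-one-residue : ∀ k → -[1+ 0 ] %ℕ suc k ≡ (ℤ.+ k) %ℕ suc k
minus-one-residue zero    = refl
minus-one-residue (suc j) = sym (ℕD.m<n⇒m%n≡m (ℕP.n<1+n (suc j)))

-- The affine root data of type A^{(1)}_{e-1} for a fixed e = k + 1 ≥ 1.
module AffineA (k : ℕ) where

  e : ℕ
  e = suc k

  ResidueInvariant : (ℤ → ℚ) → Set
  ResidueInvariant f = ∀ m m' → m %ℕ e ≡ m' %ℕ e → f m ≡ f m'

  residue-idem : ∀ m → (ℤ.+ (m %ℕ e)) %ℕ e ≡ m %ℕ e
  residue-idem m = ℕD.m<n⇒m%n≡m (n%ℕd<d m e)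

  residue-e : (ℤ.+ e) %ℕ e ≡ (ℤ.+ 0) %ℕ e
  residue-e = ℕD.n%n≡0 e

  -- Cyclic summation by parts: for f invariant under residues,
  -- Σ_i f_i (2 f_i - f_{i-1} - f_{i+1}) = Σ_i (f_i - f_{i-1})².
  cyclic-energy : (f : ℤ → ℚ) → ResidueInvariant f →
    sumFin e (λ i → f (ℤ.+ toℕ i) * ((- 1ℚ) * f (ℤ.+ toℕ i ℤ.- ℤ.+ 1)
                                   + ((1ℚ + 1ℚ) * f (ℤ.+ toℕ i) + (- 1ℚ) * f (ℤ.+ toℕ i ℤ.+ ℤ.+ 1))))
      ≡ sumFin e (λ i → (f (ℤ.+ toℕ i) - f (ℤ.+ toℕ i ℤ.- ℤ.+ 1)) * (f (ℤ.+ toℕ i) - f (ℤ.+ toℕ i ℤ.- ℤ.+ 1)))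
  cyclic-energy f f-inv = begin
    sumFin e (λ i → a (toℕ i) * ((- 1ℚ) * p (toℕ i) + ((1ℚ + 1ℚ) * a (toℕ i) + (- 1ℚ) * f (ℤ.+ toℕ i ℤ.+ ℤ.+ 1))))
      ≡⟨ sumFin-cong e (λ i → pointwise (toℕ i)) ⟩
    sumFin e (λ i → (R (toℕ i) + Δ squares (toℕ i)) + (- 1ℚ) * Δ products (toℕ i))
      ≡⟨ trans (sumFin-+ e (λ i → R (toℕ i) + Δ squares (toℕ i)) (λ i → (- 1ℚ) * Δ products (toℕ i)))
               (cong₂ _+_ (sumFin-+ e (R ∘ toℕ) (Δ squares ∘ toℕ)) (sumFin-* e (- 1ℚ) (Δ products ∘ toℕ))) ⟩
    (sumFin e (R ∘ toℕ) + sumFin e (Δ squares ∘ toℕ)) + (- 1ℚ) * sumFin e (Δ products ∘ toℕ)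
      ≡⟨ cong₂ (λ s t → (sumFin e (R ∘ toℕ) + s) + (- 1ℚ) * t)
               (trans (sumFin-telescope e squares) (closes squares squares-closed))
               (trans (sumFin-telescope e products) (closes products products-closed)) ⟩
    (sumFin e (R ∘ toℕ) + 0ℚ) + (- 1ℚ) * 0ℚ
      ≡⟨ drop-zeros (sumFin e (R ∘ toℕ)) ⟩
    sumFin e (R ∘ toℕ) ∎
    where
    a p R squares products : ℕ → ℚ
    a n = f (ℤ.+ n)
    p n = f (ℤ.+ n ℤ.- ℤ.+ 1)
    R n = (a n - p n) * (a n - p n)
    squares n = p n * p n
    products n = p n * a n

    Δ : (ℕ → ℚ) → ℕ → ℚ
    Δ g n = g (suc n) - g n

    wrap : p 0 ≡ p e
    wrap = f-inv -[1+ 0 ] (ℤ.+ k) (minus-one-residue k)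
    wrap′ : a e ≡ a 0
    wrap′ = f-inv (ℤ.+ e) (ℤ.+ 0) residue-e

    squares-closed : squares e ≡ squares 0
    squares-closed = sym (cong₂ _*_ wrap wrap)
    products-closed : products e ≡ products 0
    products-closed = cong₂ _*_ (sym wrap) wrap′

    closes : ∀ g → g e ≡ g 0 → g e - g 0 ≡ 0ℚ
    closes g g-closed = trans (cong (_- g 0) g-closed) (ℚP.+-inverseʳ (g 0))

    split : ∀ a p a⁺ → a * ((- 1ℚ) * p + ((1ℚ + 1ℚ) * a + (- 1ℚ) * a⁺))
                     ≡ ((a - p) * (a - p) + (a * a - p * p)) + (- 1ℚ) * (a * a⁺ - p * a)
    split = solve-∀ ℚ-ring
    drop-zeros : ∀ r → (r + 0ℚ) + (- 1ℚ) * 0ℚ ≡ r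
    drop-zeros = solve-∀ ℚ-ring

    pointwise : ∀ n → a n * ((- 1ℚ) * p n + ((1ℚ + 1ℚ) * a n + (- 1ℚ) * f (ℤ.+ n ℤ.+ ℤ.+ 1)))
                    ≡ (R n + Δ squares n) + (- 1ℚ) * Δ products n
    pointwise n = begin
      a n * ((- 1ℚ) * p n + ((1ℚ + 1ℚ) * a n + (- 1ℚ) * f (ℤ.+ n ℤ.+ ℤ.+ 1)))
        ≡⟨ cong (λ t → a n * ((- 1ℚ) * p n + ((1ℚ + 1ℚ) * a n + (- 1ℚ) * f t))) (+-one n) ⟩
      a n * ((- 1ℚ) * p n + ((1ℚ + 1ℚ) * a n + (- 1ℚ) * a (suc n)))
        ≡⟨ split (a n) (p n) (a (suc n)) ⟩
      (R n + Δ squares n) + (- 1ℚ) * Δ products n ∎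

  Λ-residue : ∀ m m' → m %ℕ e ≡ m' %ℕ e → Λ e m ≡ Λ e m'
  Λ-residue m m' eq = cong (λ r → (λ j → if ⌊ toℕ j ℕ.≟ r ⌋ then 1ℚ else 0ℚ) , 0ℚ) eq

  linear-Λs : ∀ {ψ : H* e → ℚ} → Linear ψ → ∀ {f : ℤ → ℚ} → (∀ m → ψ (Λ e m) ≡ f m) →
    ∀ {l} (t : Vec ℤ l) → ψ (Λs e t) ≡ sumVec (Vec.map f t)
  linear-Λs lin ψΛ≡f []      = linear-zero lin
  linear-Λs lin ψΛ≡f (m ∷ t) = trans (additive lin (Λ e m) (Λs e t)) (cong₂ _+_ (ψΛ≡f m) (linear-Λs lin ψΛ≡f t))

  count : ∀ {l} → Vec ℤ l → Vec (List ℕ) l → ℤ → ℚ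
  count s λs m = ℕtoℚ (resCount e s λs m)

  count-invariant : ∀ {l} (s : Vec ℤ l) (λs : Vec (List ℕ) l) → ResidueInvariant (count s λs)
  count-invariant s λs m m' eq =
    cong (λ r → ℕtoℚ (length (filter (λ x → (x %ℕ e) ℕ.≟ r) (contents s λs)))) eq

  count-empty : ∀ {l} (s : Vec ℤ l) m → count s (emptyMP l) m ≡ 0ℚ
  count-empty s m = cong (λ xs → ℕtoℚ (length (filter (λ x → (x %ℕ e) ℕ.≟ (m %ℕ e)) xs))) (no-contents s)
    where
    no-contents : ∀ {l} (s : Vec ℤ l) → contents s (emptyMP l) ≡ []
    no-contents []      = refl
    no-contents (_ ∷ s) = no-contents s

  κ : Fin e → H* e
  κ zero    = δ
  κ (suc _) = zeroH

  α-unfold : ∀ i → α e i ≡ ((- 1ℚ) ⊙ Λ e (ℤ.+ toℕ i ℤ.- ℤ.+ 1))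
                         ⊕ ((ℕtoℚ 2 ⊙ Λ e (ℤ.+ toℕ i)) ⊕ (((- 1ℚ) ⊙ Λ e (ℤ.+ toℕ i ℤ.+ ℤ.+ 1)) ⊕ κ i))
  α-unfold zero    = refl
  α-unfold (suc i) = refl

  linear-α : ∀ {ψ : H* e → ℚ} → Linear ψ → ∀ i →
    ψ (α e i) ≡ (- 1ℚ) * ψ (Λ e (ℤ.+ toℕ i ℤ.- ℤ.+ 1))
              + ((1ℚ + 1ℚ) * ψ (Λ e (ℤ.+ toℕ i)) + ((- 1ℚ) * ψ (Λ e (ℤ.+ toℕ i ℤ.+ ℤ.+ 1)) + ψ (κ i)))
  linear-α {ψ} lin i = begin
    ψ (α e i)
      ≡⟨ cong ψ (α-unfold i) ⟩
    ψ (((- 1ℚ) ⊙ Λ₋) ⊕ ((ℕtoℚ 2 ⊙ Λ₀) ⊕ (((- 1ℚ) ⊙ Λ₊) ⊕ κ i)))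
      ≡⟨ additive lin ((- 1ℚ) ⊙ Λ₋) _ ⟩
    ψ ((- 1ℚ) ⊙ Λ₋) + ψ ((ℕtoℚ 2 ⊙ Λ₀) ⊕ (((- 1ℚ) ⊙ Λ₊) ⊕ κ i))
      ≡⟨ cong₂ _+_ (homogeneous lin (- 1ℚ) Λ₋) (additive lin (ℕtoℚ 2 ⊙ Λ₀) _) ⟩
    (- 1ℚ) * ψ Λ₋ + (ψ (ℕtoℚ 2 ⊙ Λ₀) + ψ (((- 1ℚ) ⊙ Λ₊) ⊕ κ i))
      ≡⟨ cong (λ t → (- 1ℚ) * ψ Λ₋ + t)
              (cong₂ _+_ (homogeneous lin (ℕtoℚ 2) Λ₀)
                         (trans (additive lin ((- 1ℚ) ⊙ Λ₊) (κ i)) (cong (_+ ψ (κ i)) (homogeneous lin (- 1ℚ) Λ₊)))) ⟩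
    (- 1ℚ) * ψ Λ₋ + ((1ℚ + 1ℚ) * ψ Λ₀ + ((- 1ℚ) * ψ Λ₊ + ψ (κ i))) ∎
    where
    Λ₋ Λ₀ Λ₊ : H* e
    Λ₋ = Λ e (ℤ.+ toℕ i ℤ.- ℤ.+ 1)
    Λ₀ = Λ e (ℤ.+ toℕ i)
    Λ₊ = Λ e (ℤ.+ toℕ i ℤ.+ ℤ.+ 1)

  -- Along m = 0, …, e the values ψ(Λ_m) have equal steps (from
  -- ψ(α_i) = 0, 0 < i < e) and return to ψ(Λ_0) = 0, hence vanish; then ψ(α_0) = 0
  -- leaves ψ(δ) = 0.
  module Vanishing {ψ : H* e → ℚ} (lin : Linear ψ) (ψΛ₀ : ψ (Λ e (ℤ.+ 0)) ≡ 0ℚ)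
                   (ψα : ∀ i → ψ (α e i) ≡ 0ℚ) where

    z : ℕ → ℚ
    z n = ψ (Λ e (ℤ.+ n))

    interior : ∀ (i : Fin k) → z (suc (suc (toℕ i))) - z (suc (toℕ i)) ≡ z (suc (toℕ i)) - z (toℕ i)
    interior i = equal-steps (z (toℕ i)) (z (suc t)) (z (suc (suc t))) (begin
      (- 1ℚ) * z t + ((1ℚ + 1ℚ) * z (suc t) + ((- 1ℚ) * z (suc (suc t)) + 0ℚ))
        ≡⟨ cong₂ (λ a b → (- 1ℚ) * z t + ((1ℚ + 1ℚ) * z (suc t) + ((- 1ℚ) * ψ (Λ e a) + b)))
                 (sym (+-one (suc t))) (sym (linear-zero lin)) ⟩
      (- 1ℚ) * z t + ((1ℚ + 1ℚ) * z (suc t) + ((- 1ℚ) * ψ (Λ e (ℤ.+ suc t ℤ.+ ℤ.+ 1)) + ψ zeroH))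
        ≡⟨ linear-α lin (suc i) ⟨
      ψ (α e (suc i))
        ≡⟨ ψα (suc i) ⟩
      0ℚ ∎)
      where
      t : ℕ
      t = toℕ i
      equal-steps : ∀ a b c → (- 1ℚ) * a + ((1ℚ + 1ℚ) * b + ((- 1ℚ) * c + 0ℚ)) ≡ 0ℚ → c - b ≡ b - a
      equal-steps a b c eq = begin
        c - b                                                              ≡⟨ rearrange a b c ⟩
        (b - a) - ((- 1ℚ) * a + ((1ℚ + 1ℚ) * b + ((- 1ℚ) * c + 0ℚ)))     ≡⟨ cong (λ x → (b - a) - x) eq ⟩
        (b - a) - 0ℚ                                                        ≡⟨ ℚP.+-identityʳ (b - a) ⟩
        b - a                                                              ∎
        where
        rearrange : ∀ a b c → c - b ≡ (b - a) - ((- 1ℚ) * a + ((1ℚ + 1ℚ) * b + ((- 1ℚ) * c + 0ℚ)))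
        rearrange = solve-∀ ℚ-ring

    z-vanishes : ∀ j → j ℕ.≤ e → z j ≡ 0ℚ
    z-vanishes j j≤e = trans (equal-steps-constant k z equal-steps (cong ψ (Λ-residue (ℤ.+ e) (ℤ.+ 0) residue-e)) j j≤e) ψΛ₀
      where
      equal-steps : ∀ j → j ℕ.< k → z (suc (suc j)) - z (suc j) ≡ z (suc j) - z j
      equal-steps j j<k = subst (λ t → z (suc (suc t)) - z (suc t) ≡ z (suc t) - z t)
                                (FinP.toℕ-fromℕ< j<k) (interior (fromℕ< j<k))

    vanish-Λ : ∀ m → ψ (Λ e m) ≡ 0ℚ
    vanish-Λ m = trans (cong ψ (Λ-residue m (ℤ.+ (m %ℕ e)) (sym (residue-idem m))))
                       (z-vanishes (m %ℕ e) (ℕP.<⇒≤ (n%ℕd<d m e)))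

    vanish-δ : ψ δ ≡ 0ℚ
    vanish-δ = begin
      ψ δ
        ≡⟨ only-δ (ψ δ) ⟩
      (- 1ℚ) * 0ℚ + ((1ℚ + 1ℚ) * 0ℚ + ((- 1ℚ) * 0ℚ + ψ δ))
        ≡⟨ cong₂ (λ a b → (- 1ℚ) * a + ((1ℚ + 1ℚ) * b + ((- 1ℚ) * 0ℚ + ψ δ)))
                 (sym (vanish-Λ (ℤ.+ 0 ℤ.- ℤ.+ 1))) (sym (vanish-Λ (ℤ.+ 0))) ⟩
      (- 1ℚ) * ψ (Λ e (ℤ.+ 0 ℤ.- ℤ.+ 1)) + ((1ℚ + 1ℚ) * ψ (Λ e (ℤ.+ 0)) + ((- 1ℚ) * 0ℚ + ψ δ))
        ≡⟨ cong (λ c → (- 1ℚ) * ψ (Λ e (ℤ.+ 0 ℤ.- ℤ.+ 1)) + ((1ℚ + 1ℚ) * ψ (Λ e (ℤ.+ 0)) + ((- 1ℚ) * c + ψ δ)))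
                (sym (vanish-Λ (ℤ.+ 0 ℤ.+ ℤ.+ 1))) ⟩
      (- 1ℚ) * ψ (Λ e (ℤ.+ 0 ℤ.- ℤ.+ 1)) + ((1ℚ + 1ℚ) * ψ (Λ e (ℤ.+ 0)) + ((- 1ℚ) * ψ (Λ e (ℤ.+ 0 ℤ.+ ℤ.+ 1)) + ψ δ))
        ≡⟨ linear-α lin zero ⟨
      ψ (α e zero)
        ≡⟨ ψα zero ⟩
      0ℚ ∎
      where
      only-δ : ∀ y → y ≡ (- 1ℚ) * 0ℚ + ((1ℚ + 1ℚ) * 0ℚ + ((- 1ℚ) * 0ℚ + y))
      only-δ = solve-∀ ℚ-ring

  -- For the form of the paper, pairing with α_i reads off the Λ_i-coordinate:
  -- ψ_i x = (x , α_i) - x_i is linear and vanishes on Λ_0 and on every α_j.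
  module Standard (G : GramData e) (std : IsStandardForm e G) where
    open GramForm G public
    open IsStandardForm std

    Λ₀-discrepancy : ∀ i → B (Λ e (ℤ.+ 0)) (α e i) - proj₁ (Λ e (ℤ.+ 0)) i ≡ 0ℚ
    Λ₀-discrepancy i = trans (cong (_- proj₁ (Λ e (ℤ.+ 0)) i) (Λ₀α i)) (kron0-cancels i)
      where
      kron0-cancels : ∀ i → kron0 i - proj₁ (Λ e (ℤ.+ 0)) i ≡ 0ℚ
      kron0-cancels zero    = refl
      kron0-cancels (suc _) = refl

    α-discrepancy : ∀ i j → B (α e j) (α e i) - proj₁ (α e j) i ≡ 0ℚ
    α-discrepancy i j = trans (cong (_- proj₁ (α e j) i) (αα j i)) (ℚP.+-inverseʳ (cartan e j i))

    module Discrepancy (i : Fin e) =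
      Vanishing {ψ = λ x → B x (α e i) - proj₁ x i}
                (linear-sub (B-linearˡ (α e i)) (coordinate-linear i)) (Λ₀-discrepancy i) (α-discrepancy i)

    Λ-α : ∀ m i → B (Λ e m) (α e i) ≡ proj₁ (Λ e m) i
    Λ-α m i = x∙y⁻¹≈ε⇒x≈y _ _ (Discrepancy.vanish-Λ i m)

    δ-α : ∀ i → B δ (α e i) ≡ 0ℚ
    δ-α i = trans (sym (ℚP.+-identityʳ (B δ (α e i)))) (Discrepancy.vanish-δ i)

    module RootCombination (c : ℤ → ℚ) (c-inv : ResidueInvariant c) where

      S : H* e
      S = sumHFin e (λ i → c (ℤ.+ toℕ i) ⊙ α e i)

      ĉ : H* e
      ĉ = (λ j → c (ℤ.+ toℕ j)) , 0ℚ

      S-left : ∀ z → B S z ≡ sumFin e (λ i → c (ℤ.+ toℕ i) * B (α e i) z)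
      S-left z = trans (linear-sumHFin (B-linearˡ z) e (λ i → c (ℤ.+ toℕ i) ⊙ α e i))
                       (sumFin-cong e (λ i → homogeneous (B-linearˡ z) (c (ℤ.+ toℕ i)) (α e i)))

      S-right : ∀ x → (∀ i → B x (α e i) ≡ proj₁ x i) → B x S ≡ pairing ĉ x
      S-right x@(u , a) x-coords = begin
        B x S
          ≡⟨ trans (B-sym x S) (S-left x) ⟩
        sumFin e (λ i → c (ℤ.+ toℕ i) * B (α e i) x)
          ≡⟨ sumFin-cong e (λ i → trans (cong (c (ℤ.+ toℕ i) *_) (trans (B-sym (α e i) x) (x-coords i)))
                                        (ℚP.*-comm (c (ℤ.+ toℕ i)) (u i))) ⟩
        sumFin e (λ i → u i * c (ℤ.+ toℕ i))
          ≡⟨ ℚP.+-identityʳ _ ⟨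
        sumFin e (λ i → u i * c (ℤ.+ toℕ i)) + 0ℚ
          ≡⟨ cong (sumFin e (λ i → u i * c (ℤ.+ toℕ i)) +_) (ℚP.*-zeroʳ a) ⟨
        pairing ĉ x ∎

      ĉ-Λ : ∀ m → pairing ĉ (Λ e m) ≡ c m
      ĉ-Λ m = begin
        sumFin e (λ j → indicator (m %ℕ e) (toℕ j) * c (ℤ.+ toℕ j)) + 0ℚ
          ≡⟨ ℚP.+-identityʳ _ ⟩
        sumFin e (λ j → indicator (m %ℕ e) (toℕ j) * c (ℤ.+ toℕ j))
          ≡⟨ sumFin-indicator e (λ n → c (ℤ.+ n)) (m %ℕ e) (n%ℕd<d m e) ⟩
        c (ℤ.+ (m %ℕ e))
          ≡⟨ c-inv (ℤ.+ (m %ℕ e)) m (residue-idem m) ⟩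
        c m ∎

      ĉ-κ : ∀ i → pairing ĉ (κ i) ≡ 0ℚ
      ĉ-κ zero    = begin
        sumFin e (λ j → 0ℚ * c (ℤ.+ toℕ j)) + 0ℚ ≡⟨ ℚP.+-identityʳ _ ⟩
        sumFin e (λ j → 0ℚ * c (ℤ.+ toℕ j))      ≡⟨ sumFin-* e 0ℚ (λ j → c (ℤ.+ toℕ j)) ⟩
        0ℚ * sumFin e (λ j → c (ℤ.+ toℕ j))      ≡⟨ ℚP.*-zeroˡ (sumFin e (λ j → c (ℤ.+ toℕ j))) ⟩
        0ℚ                                         ∎
      ĉ-κ (suc _) = linear-zero (pairing-linear ĉ)

      Λ-S : ∀ m → B (Λ e m) S ≡ c m
      Λ-S m = trans (S-right (Λ e m) (Λ-α m)) (ĉ-Λ m)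

      δ-S : B δ S ≡ 0ℚ
      δ-S = trans (S-right δ δ-α) (ĉ-κ zero)

      α-S : ∀ i → B (α e i) S ≡ (- 1ℚ) * c (ℤ.+ toℕ i ℤ.- ℤ.+ 1)
                                + ((1ℚ + 1ℚ) * c (ℤ.+ toℕ i) + (- 1ℚ) * c (ℤ.+ toℕ i ℤ.+ ℤ.+ 1))
      α-S i = begin
        B (α e i) S
          ≡⟨ trans (S-right (α e i) (αα i)) (linear-α (pairing-linear ĉ) i) ⟩
        (- 1ℚ) * pairing ĉ (Λ e m₋) + ((1ℚ + 1ℚ) * pairing ĉ (Λ e m₀) + ((- 1ℚ) * pairing ĉ (Λ e m₊) + pairing ĉ (κ i)))
          ≡⟨ cong₂ (λ a b → (- 1ℚ) * a + b) (ĉ-Λ m₋)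
                   (cong₂ (λ a b → (1ℚ + 1ℚ) * a + b) (ĉ-Λ m₀)
                          (trans (cong₂ (λ a b → (- 1ℚ) * a + b) (ĉ-Λ m₊) (ĉ-κ i)) (ℚP.+-identityʳ _))) ⟩
        (- 1ℚ) * c m₋ + ((1ℚ + 1ℚ) * c m₀ + (- 1ℚ) * c m₊) ∎
        where
        m₋ m₀ m₊ : ℤ
        m₋ = ℤ.+ toℕ i ℤ.- ℤ.+ 1
        m₀ = ℤ.+ toℕ i
        m₊ = ℤ.+ toℕ i ℤ.+ ℤ.+ 1

      S-S : B S S ≡ sumFin e (λ i → (c (ℤ.+ toℕ i) - c (ℤ.+ toℕ i ℤ.- ℤ.+ 1))
                                   * (c (ℤ.+ toℕ i) - c (ℤ.+ toℕ i ℤ.- ℤ.+ 1)))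
      S-S = trans (S-left S) (trans (sumFin-cong e (λ i → cong (c (ℤ.+ toℕ i) *_) (α-S i))) (cyclic-energy c c-inv))

      S-null : (∀ m → c m ≡ 0ℚ) → ∀ z → B S z ≡ 0ℚ
      S-null c≡0 z = begin
        B S z                                            ≡⟨ S-left z ⟩
        sumFin e (λ i → c (ℤ.+ toℕ i) * B (α e i) z)    ≡⟨ sumFin-cong e (λ i → cong (_* B (α e i) z) (c≡0 (ℤ.+ toℕ i))) ⟩
        sumFin e (λ i → 0ℚ * B (α e i) z)               ≡⟨ sumFin-* e 0ℚ (λ i → B (α e i) z) ⟩
        0ℚ * sumFin e (λ i → B (α e i) z)               ≡⟨ ℚP.*-zeroˡ (sumFin e (λ i → B (α e i) z)) ⟩
        0ℚ                                                ∎

mainTheorem7 : (e : ℕ) .{{_ : NonZero e}} → 2 ≤ e →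
    (l : ℕ) → 1 ≤ l →
    (G : GramData e) → IsStandardForm e G →
    (s : Vec ℤ l) (λs : Vec (List ℕ) l) → IsMultipartition λs →
    norm e G s λs ≡ norm e G s (emptyMP l) - blockWeight e s λs
mainTheorem7 zero    ()
mainTheorem7 (suc k) _ l _ G std s λs _ = begin
  norm e G s λs
    ≡⟨ half-square-shift D (Λs e s) Sλ.S S∅.S (S∅.S-null (count-empty s)) ⟩
  norm e G s (emptyMP l) - (B D Sλ.S + B (Λs e s) Sλ.S - ½ * B Sλ.S Sλ.S)
    ≡⟨ cong (λ t → norm e G s (emptyMP l) - t)
            (cong₂ _-_ (cong₂ _+_ D⊥S (linear-Λs (B-linearˡ Sλ.S) Sλ.Λ-S s)) (cong (½ *_) Sλ.S-S)) ⟩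
  norm e G s (emptyMP l) - (0ℚ + V - ½ * W)
    ≡⟨ cong (λ v → norm e G s (emptyMP l) - (v - ½ * W)) (ℚP.+-identityˡ V) ⟩
  norm e G s (emptyMP l) - blockWeight e s λs ∎
  where
  open AffineA k
  open Standard G std
  module Sλ = RootCombination (count s λs) (count-invariant s λs)
  module S∅ = RootCombination (count s (emptyMP l)) (count-invariant s (emptyMP l))

  D : H* e
  D = (- Δs e s) ⊙ δ
  D⊥S : B D Sλ.S ≡ 0ℚ
  D⊥S = trans (homogeneous (B-linearˡ Sλ.S) (- Δs e s) δ)
              (trans (cong (- Δs e s *_) Sλ.δ-S) (ℚP.*-zeroʳ (- Δs e s)))

  V W : ℚ
  V = sumVec (Vec.map (count s λs) s)
  W = sumFin e (λ i → (count s λs (ℤ.+ toℕ i) - count s λs (ℤ.+ toℕ i ℤ.- ℤ.+ 1))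
                    * (count s λs (ℤ.+ toℕ i) - count s λs (ℤ.+ toℕ i ℤ.- ℤ.+ 1)))
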